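{- Let $G=(V,E,\omega,c)$ be a weighted graph and let $\pi=\{A_1,\dots,A_k\}\in\mathcal{D}_k(V)$ be a $k$-subpartition attaining $\iota_k(G)$ (mean or max version). Let $A_{k+1}=V\setminus\bigcup_{i=1}^k A_i$ and $\overline{\pi}=\{A_1,\dots,A_{k+1}\}$. Then $\iota_k(G)=\iota_k(G/\overline{\pi})$.
   Context: A weighted graph $G=(V,E,\omega,c)$ is a finite simple graph with $\omega:V\to\mathbb{Q}^+$, $c:E\to\mathbb{Q}^+$. For $A,B\subseteq V$, $\omega(A)=\sum_{u\in A}\omega(u)$, $E(A,B)$ is the set of edges with one end in $A$ and the other in $B$, $c(A,B)=\sum_{e\in E(A,B)}c(e)$, $c(A)=c(A,V\setminus A)$. $\mathcal{D}_k(V)$ is the set of families of $k$ pairwise disjoint nonempty subsets of $V$; $\iota^m_k=\min_{\mathcal{D}_k(V)}\frac1k\sum_i c(A_i)/\omega(A_i)$, $\iota^M_k=\min_{\mathcal{D}_k(V)}\max_i c(A_i)/\omega(A_i)$. Quotient graph: for a family $\{A_1,\dots,A_m\}$ of pairwise disjoint sets with union $V$, let $A_i^1,\dots,A_i^{n_i}$ be the vertex sets of the connected components of the subgraph induced on $A_i$. The quotient $G/\pi$ is the weighted graph with vertex set $\{v_i^r: 1\le i\le m, 1\le r\le n_i\}$, an edge $v_i^rv_j^s$ whenever $E(A_i^r,A_j^s)\neq\emptyset$, vertex weights $\omega'(v_i^r)=\omega(A_i^r)$ and edge weights $c'(v_i^rv_j^s)=c(A_i^r,A_j^s)$. -}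

module Defs where

open import Data.Nat as ℕ using (ℕ; zero; suc)
open import Data.Fin as Fin using (Fin; zero; suc)
open import Data.Bool using (Bool; true; false; if_then_else_)
open import Data.Rational using (ℚ; 0ℚ; _+_; _*_; _÷_; _⊔_; _≤_; _<_; _/_; ≢-nonZero)
open import Data.Rational.Properties using (_≟_)
open import Data.Integer using (+_)
open import Data.Product using (Σ; ∃; ∃-syntax; _×_; _,_)
open import Data.Sum using (_⊎_)
open import Data.Empty using (⊥)
open import Relation.Nullary using (¬_; yes; no)
open import Relation.Nullary.Decidable using (⌊_⌋)
open import Relation.Binary.PropositionalEquality using (_≡_; _≢_)

sumFin : (n : ℕ) → (Fin n → ℚ) → ℚ
sumFin zero    f = 0ℚ
sumFin (suc n) f = f zero + sumFin n (λ i → f (suc i))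

-- maximum of f over Fin n (convention: 0 for n = 0; never used since k ≥ 1)
maxFin : (n : ℕ) → (Fin n → ℚ) → ℚ
maxFin zero          f = 0ℚ
maxFin (suc zero)    f = f zero
maxFin (suc (suc n)) f = f zero ⊔ maxFin (suc n) (λ i → f (suc i))

-- p / q, with the (never used) convention p / 0 = 0
_div_ : ℚ → ℚ → ℚ
p div q with q ≟ 0ℚ
... | yes _  = 0ℚ
... | no q≢0 = _÷_ p q {{≢-nonZero q≢0}}

-- Weighted graphs: vertex set Fin n, simple (symmetric, irreflexive)
-- adjacency, positive rational vertex weights, positive rational edge
-- weights (c u v is only meaningful when u,v are adjacent).

record WGraph : Set where
  field
    n       : ℕ
    adj     : Fin n → Fin n → Bool
    adj-sym : ∀ u v → adj u v ≡ adj v u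
    adj-irr : ∀ u → adj u u ≡ false
    ω       : Fin n → ℚ
    ω-pos   : ∀ u → 0ℚ < ω u
    c       : Fin n → Fin n → ℚ
    c-sym   : ∀ u v → c u v ≡ c v u
    c-pos   : ∀ u v → adj u v ≡ true → 0ℚ < c u v

open WGraph public

VSet : WGraph → Set
VSet G = Fin (n G) → Bool

wt : (G : WGraph) → VSet G → ℚ
wt G A = sumFin (n G) (λ u → if A u then ω G u else 0ℚ)

-- c(A,B) = sum of c(e) over edges e with one end in A, the other in B
-- (for disjoint A, B: sum over ordered adjacent pairs u ∈ A, v ∈ B)
cut : (G : WGraph) → VSet G → VSet G → ℚ
cut G A B = sumFin (n G) (λ u → sumFin (n G) (λ v →
  if A u then (if B v then (if adj G u v then c G u v else 0ℚ) else 0ℚ) else 0ℚ))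

compl : (G : WGraph) → VSet G → VSet G
compl G A u = if A u then false else true

bdry : (G : WGraph) → VSet G → ℚ
bdry G A = cut G A (compl G A)

ratio : (G : WGraph) → VSet G → ℚ
ratio G A = bdry G A div wt G A

Family : WGraph → ℕ → Set
Family G k = Fin k → VSet G

InD : (G : WGraph) (k : ℕ) → Family G k → Set
InD G k A =
  (∀ i → ∃[ u ] (A i u ≡ true)) ×
  (∀ i j u → i ≢ j → A i u ≡ true → A j u ≡ true → ⊥)

data Version : Set where
  mean maxv : Version

obj : Version → (G : WGraph) (k : ℕ) → Family G k → ℚ
obj mean G k A = sumFin k (λ i → ratio G (A i)) div (+ k / 1)
obj maxv G k A = maxFin k (λ i → ratio G (A i))

Attains : Version → (G : WGraph) (k : ℕ) → Family G k → Set
Attains v G k A = InD G k A × (∀ B → InD G k B → obj v G k A ≤ obj v G k B)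

IsIota : Version → (G : WGraph) (k : ℕ) → ℚ → Set
IsIota v G k x =
  (∃[ B ] (InD G k B × obj v G k B ≡ x)) ×
  (∀ B → InD G k B → x ≤ obj v G k B)

InUnion : ∀ {G k} → Family G k → Fin (n G) → Set
InUnion {k = k} A u = ∃[ i ] (A i u ≡ true)

data Reach (G : WGraph) (P : Fin (n G) → Set) (u : Fin (n G)) : Fin (n G) → Set where
  here : P u → Reach G P u u
  step : ∀ {v w} → Reach G P u v → adj G v w ≡ true → P w → Reach G P u w

SameComp : (G : WGraph) (k : ℕ) → Family G k → Fin (n G) → Fin (n G) → Set
SameComp G k A u v =
  (∃[ i ] Reach G (λ w → A i w ≡ true) u v) ⊎
  Reach G (λ w → ¬ InUnion {G} {k} A w) u v

-- H is (isomorphic to) the quotient G/π̄, with q sending each vertex of G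
-- to the vertex of H representing its component.
record IsQuotient (G : WGraph) (k : ℕ) (A : Family G k) (H : WGraph) : Set where
  field
    q      : Fin (n G) → Fin (n H)
    q-surj : ∀ y → ∃[ u ] (q u ≡ y)
    q-comp : ∀ u v → (q u ≡ q v → SameComp G k A u v) × (SameComp G k A u v → q u ≡ q v)
    q-ω    : ∀ y → ω H y ≡ wt G (λ u → ⌊ q u Fin.≟ y ⌋)
    q-adj  : ∀ y z → (adj H y z ≡ true →
                        y ≢ z × ∃[ u ] ∃[ v ] (q u ≡ y × q v ≡ z × adj G u v ≡ true))
                   × (y ≢ z × (∃[ u ] ∃[ v ] (q u ≡ y × q v ≡ z × adj G u v ≡ true))
                        → adj H y z ≡ true)
    q-c    : ∀ y z → adj H y z ≡ true →
               c H y z ≡ cut G (λ u → ⌊ q u Fin.≟ y ⌋) (λ v → ⌊ q v Fin.≟ z ⌋)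

module Submission where

-- Let q : V(G) → V(H) send each vertex to the vertex of
-- the quotient representing its component.  For a vertex set B of H write
-- q⁻¹B for its preimage.  Because the weights of H are the fibre sums of
-- the weights of G, and H has an edge between two distinct fibres exactly
-- when G does, regrouping the finite sums by fibres gives
--   ω_H(B) = ω_G(q⁻¹B),   c_H(B, V∖B) = c_G(q⁻¹B, V∖q⁻¹B),
-- so every ratio c(B)/ω(B), and hence the objective, is preserved by q⁻¹.
-- Preimages of k-subpartitions of H are k-subpartitions of G (q is onto),
-- so ι_k(H) ≥ ι_k(G).  Conversely each A_i is a union of fibres of q (a
-- fibre is connected inside one block of π̄), so A_i = q⁻¹(q(A_i)) and the
-- images q(A_i) form a k-subpartition of H with the optimal value.

open import Defs
open import Data.Nat using (ℕ; _≤_; zero; suc)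
open import Data.Fin as Fin using (Fin; zero; suc)
open import Data.Fin.Properties using (any?)
open import Data.Bool as Bool using (Bool; true; false; if_then_else_)
open import Data.Rational using (ℚ; 0ℚ; _+_; _⊔_)
import Data.Rational as ℚ
open import Data.Rational.Properties using (+-assoc; +-comm; +-identityˡ; +-identityʳ)
open import Data.Product using (∃-syntax; _×_; _,_; proj₁; proj₂)
open import Data.Sum using (inj₁; inj₂)
open import Data.Empty using (⊥-elim)
open import Relation.Nullary using (yes; no; Dec)
open import Relation.Nullary.Decidable using (⌊_⌋; _×-dec_)
open import Relation.Binary.PropositionalEquality
open import Function using (_∘_)
import Data.Integer as ℤ

-- x guarded by a boolean; the nested conditionals in Defs are iterated guards.
when : Bool → ℚ → ℚ
when b x = if b then x else 0ℚ

when-zero : ∀ b → when b 0ℚ ≡ 0ℚ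
when-zero true  = refl
when-zero false = refl

when-comm : ∀ a b x → when a (when b x) ≡ when b (when a x)
when-comm true  b x = refl
when-comm false b x = sym (when-zero b)

sum-cong : ∀ n {f g : Fin n → ℚ} → (∀ i → f i ≡ g i) → sumFin n f ≡ sumFin n g
sum-cong zero    eq = refl
sum-cong (suc n) eq = cong₂ _+_ (eq zero) (sum-cong n (eq ∘ suc))

sum-zero : ∀ n {f : Fin n → ℚ} → (∀ i → f i ≡ 0ℚ) → sumFin n f ≡ 0ℚ
sum-zero zero    eq = refl
sum-zero (suc n) eq =
  trans (cong₂ _+_ (eq zero) (sum-zero n (eq ∘ suc))) (+-identityˡ 0ℚ)

+-interchange : ∀ a b c d → (a + b) + (c + d) ≡ (a + c) + (b + d)
+-interchange a b c d = begin
  (a + b) + (c + d)  ≡⟨ +-assoc a b (c + d) ⟩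
  a + (b + (c + d))  ≡⟨ cong (a +_) (sym (+-assoc b c d)) ⟩
  a + ((b + c) + d)  ≡⟨ cong (λ t → a + (t + d)) (+-comm b c) ⟩
  a + ((c + b) + d)  ≡⟨ cong (a +_) (+-assoc c b d) ⟩
  a + (c + (b + d))  ≡⟨ sym (+-assoc a c (b + d)) ⟩
  (a + c) + (b + d)  ∎
  where open ≡-Reasoning

sum-+ : ∀ n (f g : Fin n → ℚ) → sumFin n (λ i → f i + g i) ≡ sumFin n f + sumFin n g
sum-+ zero    f g = sym (+-identityˡ 0ℚ)
sum-+ (suc n) f g =
  trans (cong (f zero + g zero +_) (sum-+ n (f ∘ suc) (g ∘ suc)))
        (+-interchange (f zero) (g zero) _ _)

sum-swap : ∀ n m (g : Fin n → Fin m → ℚ) →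
  sumFin n (λ u → sumFin m (g u)) ≡ sumFin m (λ y → sumFin n (λ u → g u y))
sum-swap zero    m g = sym (sum-zero m (λ _ → refl))
sum-swap (suc n) m g =
  trans (cong (sumFin m (g zero) +_) (sum-swap n m (g ∘ suc)))
        (sym (sum-+ m (g zero) (λ y → sumFin n (λ u → g (suc u) y))))

when-sum : ∀ b n (f : Fin n → ℚ) → when b (sumFin n f) ≡ sumFin n (λ i → when b (f i))
when-sum true  n f = refl
when-sum false n f = sym (sum-zero n (λ _ → refl))

sum-delta : ∀ m (x : Fin m) (a : ℚ) → sumFin m (λ y → when ⌊ x Fin.≟ y ⌋ a) ≡ a
sum-delta (suc m) zero    a =
  trans (cong (a +_) (sum-zero m (λ _ → refl))) (+-identityʳ a)
sum-delta (suc m) (suc x) a = begin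
  0ℚ + sumFin m (λ y → when ⌊ suc x Fin.≟ suc y ⌋ a)
    ≡⟨ cong (0ℚ +_) (sum-cong m (λ y → cong (λ b → when b a) (suc-≟ y))) ⟩
  0ℚ + sumFin m (λ y → when ⌊ x Fin.≟ y ⌋ a)
    ≡⟨ +-identityˡ _ ⟩
  sumFin m (λ y → when ⌊ x Fin.≟ y ⌋ a)
    ≡⟨ sum-delta m x a ⟩
  a  ∎
  where
  open ≡-Reasoning
  -- the recursive clause of _≟_ only computes once x ≟ y is evaluated
  suc-≟ : ∀ y → ⌊ suc x Fin.≟ suc y ⌋ ≡ ⌊ x Fin.≟ y ⌋
  suc-≟ y with x Fin.≟ y
  ... | yes _ = refl
  ... | no  _ = refl

fibre : ∀ {n m} → (Fin n → Fin m) → Fin m → Fin n → Bool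
fibre q y u = ⌊ q u Fin.≟ y ⌋

when-fibre : ∀ {n m} (q : Fin n → Fin m) (g : Fin m → Bool) y u x →
  when (fibre q y u) (when (g (q u)) x) ≡ when (g y) (when (fibre q y u) x)
when-fibre q g y u x with q u Fin.≟ y
... | yes refl = refl
... | no _     = sym (when-zero (g y))

sum-fibres : ∀ n m (q : Fin n → Fin m) (g : Fin m → Bool) (f : Fin n → ℚ) →
  sumFin n (λ u → when (g (q u)) (f u))
  ≡ sumFin m (λ y → when (g y) (sumFin n (λ u → when (fibre q y u) (f u))))
sum-fibres n m q g f = begin
  sumFin n (λ u → when (g (q u)) (f u))
    ≡⟨ sum-cong n (λ u → sym (sum-delta m (q u) _)) ⟩
  sumFin n (λ u → sumFin m (λ y → when (fibre q y u) (when (g (q u)) (f u))))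
    ≡⟨ sum-swap n m _ ⟩
  sumFin m (λ y → sumFin n (λ u → when (fibre q y u) (when (g (q u)) (f u))))
    ≡⟨ sum-cong m (λ y → sum-cong n (λ u → when-fibre q g y u (f u))) ⟩
  sumFin m (λ y → sumFin n (λ u → when (g y) (when (fibre q y u) (f u))))
    ≡⟨ sum-cong m (λ y → sym (when-sum (g y) n _)) ⟩
  sumFin m (λ y → when (g y) (sumFin n (λ u → when (fibre q y u) (f u))))  ∎
  where open ≡-Reasoning

sum-fibres₂ : ∀ n m (q : Fin n → Fin m) (g h : Fin m → Bool) (F : Fin n → Fin n → ℚ) →
  sumFin n (λ u → sumFin n (λ v → when (g (q u)) (when (h (q v)) (F u v))))
  ≡ sumFin m (λ y → sumFin m (λ z → when (g y) (when (h z)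
      (sumFin n (λ u → sumFin n (λ v → when (fibre q y u) (when (fibre q z v) (F u v))))))))
sum-fibres₂ n m q g h F = begin
  sumFin n (λ u → sumFin n (λ v → when (g (q u)) (when (h (q v)) (F u v))))
    ≡⟨ sum-cong n (λ u → sym (when-sum (g (q u)) n _)) ⟩
  sumFin n (λ u → when (g (q u)) (sumFin n (λ v → when (h (q v)) (F u v))))
    ≡⟨ sum-cong n (λ u → cong (when (g (q u))) (sum-fibres n m q h (F u))) ⟩
  sumFin n (λ u → when (g (q u)) (inner u))
    ≡⟨ sum-fibres n m q g inner ⟩
  sumFin m (λ y → when (g y) (sumFin n (λ u → when (fibre q y u) (inner u))))
    ≡⟨ sum-cong m (λ y → cong (when (g y)) (regroup y)) ⟩
  sumFin m (λ y → when (g y) (sumFin m (λ z → when (h z) (block y z))))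
    ≡⟨ sum-cong m (λ y → when-sum (g y) m _) ⟩
  sumFin m (λ y → sumFin m (λ z → when (g y) (when (h z) (block y z))))  ∎
  where
  open ≡-Reasoning
  inner : Fin n → ℚ
  inner u = sumFin m (λ z → when (h z) (sumFin n (λ v → when (fibre q z v) (F u v))))
  block : Fin m → Fin m → ℚ
  block y z = sumFin n (λ u → sumFin n (λ v → when (fibre q y u) (when (fibre q z v) (F u v))))
  regroup : ∀ y → sumFin n (λ u → when (fibre q y u) (inner u))
                ≡ sumFin m (λ z → when (h z) (block y z))
  regroup y = begin
    sumFin n (λ u → when (fibre q y u) (inner u))
      ≡⟨ sum-cong n (λ u → when-sum (fibre q y u) m _) ⟩
    sumFin n (λ u → sumFin m (λ z → when (fibre q y u) (when (h z) _)))
      ≡⟨ sum-swap n m _ ⟩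
    sumFin m (λ z → sumFin n (λ u → when (fibre q y u) (when (h z) _)))
      ≡⟨ sum-cong m (λ z → sum-cong n (λ u → when-comm (fibre q y u) (h z) _)) ⟩
    sumFin m (λ z → sumFin n (λ u → when (h z) (when (fibre q y u) _)))
      ≡⟨ sum-cong m (λ z → sym (when-sum (h z) n _)) ⟩
    sumFin m (λ z → when (h z) (sumFin n (λ u → when (fibre q y u)
                                   (sumFin n (λ v → when (fibre q z v) (F u v))))))
      ≡⟨ sum-cong m (λ z → cong (when (h z))
           (sum-cong n (λ u → when-sum (fibre q y u) n _))) ⟩
    sumFin m (λ z → when (h z) (block y z))  ∎

ratio-cong : ∀ G (X Y : VSet G) → (∀ u → X u ≡ Y u) → ratio G X ≡ ratio G Y
ratio-cong G X Y eq = cong₂ _div_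
  (sum-cong (n G) λ u → sum-cong (n G) λ v →
     cong₂ (λ a b → when a (when b (when (adj G u v) (c G u v))))
           (eq u) (cong (λ b → if b then false else true) (eq v)))
  (sum-cong (n G) λ u → cong (λ b → when b (ω G u)) (eq u))

maxFin-cong : ∀ k {f g : Fin k → ℚ} → (∀ i → f i ≡ g i) → maxFin k f ≡ maxFin k g
maxFin-cong zero          eq = refl
maxFin-cong (suc zero)    eq = eq zero
maxFin-cong (suc (suc k)) eq = cong₂ _⊔_ (eq zero) (maxFin-cong (suc k) (eq ∘ suc))

obj-cong : ∀ v {G H : WGraph} k (B : Family H k) (B' : Family G k) →
  (∀ i → ratio H (B i) ≡ ratio G (B' i)) → obj v H k B ≡ obj v G k B'
obj-cong mean k B B' eq = cong (_div (ℤ.+ k ℚ./ 1)) (sum-cong k eq)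
obj-cong maxv k B B' eq = maxFin-cong k eq

module Projection (G H : WGraph) (q : Fin (n G) → Fin (n H))
  (ω-fibre : ∀ y → ω H y ≡ wt G (fibre q y))
  (c-fibre : ∀ y z → adj H y z ≡ true → c H y z ≡ cut G (fibre q y) (fibre q z))
  (adj-image : ∀ u v → adj G u v ≡ true → q u ≢ q v → adj H (q u) (q v) ≡ true)
  where

  wt-pull : (B : VSet H) → wt H B ≡ wt G (B ∘ q)
  wt-pull B = begin
    wt H B
      ≡⟨ sum-cong (n H) (λ y → cong (when (B y)) (ω-fibre y)) ⟩
    sumFin (n H) (λ y → when (B y) (wt G (fibre q y)))
      ≡⟨ sym (sum-fibres (n G) (n H) q B (ω G)) ⟩
    wt G (B ∘ q)  ∎
    where open ≡-Reasoning

  edge-weight : ∀ y z → y ≢ z →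
    when (adj H y z) (c H y z) ≡ cut G (fibre q y) (fibre q z)
  edge-weight y z y≢z with adj H y z in e
  ... | true  = c-fibre y z e
  ... | false = sym (sum-zero (n G) λ u → sum-zero (n G) λ v → no-edge u v)
    where
    no-edge : ∀ u v →
      when (fibre q y u) (when (fibre q z v) (when (adj G u v) (c G u v))) ≡ 0ℚ
    no-edge u v with q u Fin.≟ y | q v Fin.≟ z | adj G u v in a
    ... | yes refl | yes refl | true
          with () ← trans (sym e) (adj-image u v a y≢z)
    ... | yes _ | yes _ | false = refl
    ... | yes _ | no _  | _     = refl
    ... | no _  | _     | _     = refl

  -- c_H(B,C) = c_G(q⁻¹B,q⁻¹C) for disjoint B, C: regroup the double sum by
  -- pairs of fibres, which are distinct since B and C are disjoint.
  cut-pull : (B C : VSet H) → (∀ y → B y ≡ true → C y ≡ false) →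
    cut H B C ≡ cut G (B ∘ q) (C ∘ q)
  cut-pull B C disjoint = begin
    cut H B C
      ≡⟨ sum-cong (n H) (λ y → sum-cong (n H) (λ z → on-blocks y z)) ⟩
    sumFin (n H) (λ y → sumFin (n H) (λ z →
      when (B y) (when (C z) (cut G (fibre q y) (fibre q z)))))
      ≡⟨ sym (sum-fibres₂ (n G) (n H) q B C (λ u v → when (adj G u v) (c G u v))) ⟩
    cut G (B ∘ q) (C ∘ q)  ∎
    where
    open ≡-Reasoning
    on-blocks : ∀ y z → when (B y) (when (C z) (when (adj H y z) (c H y z)))
                      ≡ when (B y) (when (C z) (cut G (fibre q y) (fibre q z)))
    on-blocks y z with B y in by | C z in cz
    ... | false | _     = refl
    ... | true  | false = refl
    ... | true  | true  = edge-weight y z y≢z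
      where
      y≢z : y ≢ z
      y≢z refl with () ← trans (sym (disjoint y by)) cz

  -- c_H(B)/ω_H(B) = c_G(q⁻¹B)/ω_G(q⁻¹B); note V∖q⁻¹B = q⁻¹(V∖B).
  ratio-pull : (B : VSet H) → ratio H B ≡ ratio G (B ∘ q)
  ratio-pull B =
    cong₂ _div_ (cut-pull B (compl H B) complement-disjoint) (wt-pull B)
    where
    complement-disjoint : ∀ y → B y ≡ true → compl H B y ≡ false
    complement-disjoint y e rewrite e = refl

module Subpartitions (G H : WGraph) (k : ℕ) (q : Fin (n G) → Fin (n H)) where

  preimage-InD : (∀ y → ∃[ u ] (q u ≡ y)) →
    (B : Family H k) → InD H k B → InD G k (λ i → B i ∘ q)
  preimage-InD onto B (nonempty , disjoint) =
    (λ i → let (y , By) = nonempty i ; (u , qu≡y) = onto y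
           in u , subst (λ t → B i t ≡ true) (sym qu≡y) By) ,
    (λ i j u i≢j → disjoint i j (q u) i≢j)

  module Image (A : Family G k)
    (saturated : ∀ i u u' → q u ≡ q u' → A i u ≡ true → A i u' ≡ true)
    where

    image? : ∀ i y → Dec (∃[ u ] (q u ≡ y × A i u ≡ true))
    image? i y = any? (λ u → (q u Fin.≟ y) ×-dec (A i u Bool.≟ true))

    image : Family H k
    image i y = ⌊ image? i y ⌋

    preimage-image : ∀ i u → image i (q u) ≡ A i u
    preimage-image i u with image? i (q u)
    ... | yes (u' , qu'≡qu , Au') = sym (saturated i u' u qu'≡qu Au')
    ... | no  ∉image with A i u in Au
    ...   | true  = ⊥-elim (∉image (u , refl , Au))
    ...   | false = refl

    image-witness : ∀ i y → image i y ≡ true → ∃[ u ] (q u ≡ y × A i u ≡ true)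
    image-witness i y with image? i y
    ... | yes w = λ _ → w
    ... | no _  = λ ()

    image-InD : InD G k A → InD H k image
    image-InD (nonempty , disjoint) =
      (λ i → let (u , Au) = nonempty i in q u , trans (preimage-image i u) Au) ,
      (λ i j y i≢j in-i in-j →
        let (u , qu≡y , Aiu) = image-witness i y in-i
            (u' , qu'≡y , Aju') = image-witness j y in-j
        in disjoint i j u' i≢j (saturated i u u' (trans qu≡y (sym qu'≡y)) Aiu) Aju')

reach-start : ∀ {G P u v} → Reach G P u v → P u
reach-start (here p)     = p
reach-start (step r _ _) = reach-start r

reach-end : ∀ {G P u v} → Reach G P u v → P v
reach-end (here p)      = p
reach-end (step _ _ pw) = pw

-- The quotient map of G/π̄: a fibre is one component of one block of π̄, so
-- each block A_i of a subpartition is a union of fibres.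
quotient-saturated : ∀ {G k A H} → InD G k A → (Q : IsQuotient G k A H) →
  ∀ i u u' → IsQuotient.q Q u ≡ IsQuotient.q Q u' → A i u ≡ true → A i u' ≡ true
quotient-saturated (_ , disjoint) Q i u u' same Aiu
  with proj₁ (IsQuotient.q-comp Q u u') same
... | inj₂ path = ⊥-elim (reach-start path (i , Aiu))
... | inj₁ (j , path) with i Fin.≟ j
...   | yes refl = reach-end path
...   | no  i≢j  = ⊥-elim (disjoint i j u i≢j Aiu (reach-start path))

-- The optimal subpartition maps to a subpartition of H of the same value,
-- and every subpartition of H pulls back to one of G of the same value.
lemma4 : (v : Version) (G : WGraph) (k : ℕ) → 1 ≤ k → (A : Family G k) →
           Attains v G k A →
           (H : WGraph) → IsQuotient G k A H →
           IsIota v H k (obj v G k A)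
lemma4 v G k _ A (A∈D , A-min) H Q =
  (image , image-InD A∈D , trans (obj-pull image) (obj-cong v k _ A image-ratio)) ,
  (λ B B∈D → subst (obj v G k A ℚ.≤_) (sym (obj-pull B))
                    (A-min _ (preimage-InD q-surj B B∈D)))
  where
  open IsQuotient Q
  open Projection G H q q-ω q-c
    (λ u v e qu≢qv → proj₂ (q-adj (q u) (q v)) (qu≢qv , u , v , refl , refl , e))
  open Subpartitions G H k q
  open Image A (quotient-saturated A∈D Q)

  obj-pull : (B : Family H k) → obj v H k B ≡ obj v G k (λ i → B i ∘ q)
  obj-pull B = obj-cong v k B _ (λ i → ratio-pull (B i))

  image-ratio : ∀ i → ratio G (image i ∘ q) ≡ ratio G (A i)
  image-ratio i = ratio-cong G _ (A i) (preimage-image i)
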